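{- For every plane rooted tree $T$, $$\deg Q(T)=\sum_{v\in V(T)}\ \sum_{1\le i<j\le k_v}E^v_iE^v_j,$$ where for a vertex $v$, the subtree $T^v$ of $T$ growing upward from $v$ is decomposed as a wedge at $v$ of its $k_v$ branches $T^v=T^v_{k_v}\vee\dots\vee T^v_1$, and $E^v_i=|E(T^v_i)|$.
   Context: A plane rooted tree is a finite tree with a distinguished vertex (the root), embedded in the plane so that it grows upward from the root. A leaf is a vertex of degree $1$ different from the root. For a leaf $v$ of $T$, $r(T,v)$ denotes the number of edges of $T$ lying to the right of the unique path connecting $v$ with the root, and $T-v$ is the plane rooted tree obtained by deleting $v$ and its incident edge. The plucking polynomial $Q(T)\in\mathbb{Z}[q]$ is defined recursively: if $T$ has a single vertex then $Q(T)=1$; otherwise $Q(T)=\sum_{v \text{ leaf of } T} q^{r(T,v)}Q(T-v)$. $T^v$ consists of $v$ and all vertices and edges above it, rooted at $v$; $k_v$ is the number of edges going upward from $v$, and each branch $T^v_i$ consists of one such edge together with the subtree above its upper endpoint. -}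

module Defs where

open import Data.Nat using (ℕ; zero; suc; _+_; _*_)
open import Data.Integer using (ℤ; +_; 0ℤ; 1ℤ) renaming (_+_ to _+ℤ_)
open import Data.List using (List; []; _∷_; _++_; map; replicate; foldr)
open import Data.Product using (_×_; _,_)
open import Data.Maybe using (Maybe; just; nothing)
open import Relation.Nullary using (yes; no)
import Data.Integer.Properties as ℤP

-- Plane rooted trees: a vertex together with the ordered (left-to-right)
-- list of branches growing upward from it.

data Tree : Set where
  node : List Tree → Tree

mutual
  edges : Tree → ℕ
  edges (node cs) = forestEdges cs

  -- number of edges of a list of branches hanging from a common vertex
  -- (each branch = connecting edge + subtree above it)
  forestEdges : List Tree → ℕ
  forestEdges []       = 0
  forestEdges (c ∷ cs) = suc (edges c) + forestEdges cs

-- Polynomials in ℤ[q] as coefficient lists (constant term first).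

Poly : Set
Poly = List ℤ

_⊕_ : Poly → Poly → Poly
[]       ⊕ q        = q
(a ∷ p)  ⊕ []       = a ∷ p
(a ∷ p)  ⊕ (b ∷ q)  = (a +ℤ b) ∷ (p ⊕ q)

shift : ℕ → Poly → Poly
shift r p = replicate r 0ℤ ++ p

one : Poly
one = 1ℤ ∷ []

deg : Poly → Maybe ℕ
deg []      = nothing
deg (a ∷ p) with deg p
... | just d  = just (suc d)
... | nothing with a ℤP.≟ 0ℤ
...   | yes _ = nothing
...   | no  _ = just 0

-- For a list of branches cs hanging from a vertex, pluckF cs lists, for
-- every leaf v inside these branches, the pair (number of edges of the
-- branches lying to the right of the path from v down to the common vertex,
-- the branch list with v and its incident edge deleted).

pluckF : List Tree → List (ℕ × List Tree)
pluckF []                = []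
pluckF (node [] ∷ cs)    =
  (forestEdges cs , cs) ∷ map (λ { (r , cs') → (r , node [] ∷ cs') }) (pluckF cs)
pluckF (node ds@(_ ∷ _) ∷ cs) =
  map (λ { (r , ds') → (r + forestEdges cs , node ds' ∷ cs) }) (pluckF ds)
  ++ map (λ { (r , cs') → (r , node ds ∷ cs') }) (pluckF cs)

-- leaves v of T with (r(T,v), T - v)
plucks : Tree → List (ℕ × Tree)
plucks (node cs) = map (λ { (r , cs') → (r , node cs') }) (pluckF cs)

-- Q with fuel (fuel = number of edges, which drops by one per plucking)
Qf : ℕ → Tree → Poly
Qf _       (node [])  = one
Qf zero    t          = one
Qf (suc n) t          = foldr (λ { (r , t') acc → shift r (Qf n t') ⊕ acc }) [] (plucks t)

Q : Tree → Poly
Q t = Qf (edges t) t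

pairSum : List ℕ → ℕ
pairSum []       = 0
pairSum (x ∷ xs) = x * foldr _+_ 0 xs + pairSum xs

mutual
  branchSizes : List Tree → List ℕ
  branchSizes []       = []
  branchSizes (c ∷ cs) = suc (edges c) ∷ branchSizes cs

  vertexSum : Tree → ℕ
  vertexSum (node cs) = pairSum (branchSizes cs) + forestVertexSum cs

  forestVertexSum : List Tree → ℕ
  forestVertexSum []       = 0
  forestVertexSum (c ∷ cs) = vertexSum c + forestVertexSum cs

module Submission where

-- Q(T) has non-negative coefficients, so no cancellation can occur and
--   deg Q(T) = max over leaves v of  r(T,v) + deg Q(T - v).
-- By induction on the number of edges, deg Q(T - v) = vertexSum (T - v), so
-- the theorem reduces to a purely combinatorial fact about the right-hand
-- side: for every leaf v,  r(T,v) + vertexSum (T - v) ≤ vertexSum T,  with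
-- equality for the leftmost leaf.

open import Defs
open import Data.Maybe using (Maybe; just; nothing)
open import Relation.Binary.PropositionalEquality
  using (_≡_; refl; sym; trans; cong; module ≡-Reasoning)
open import Data.Nat using (ℕ; zero; suc; _+_; _*_; _⊔_; _≤_)
open import Data.Nat.Properties
  using ( ≤-trans; ≤-reflexive; n≤1+n; +-mono-≤; +-monoˡ-≤; *-monoʳ-≤
        ; +-suc; suc-injective; ⊔-lub; m≥n⇒m⊔n≡m; m≤n⇒m⊔n≡n; module ≤-Reasoning)
open import Data.Integer using () renaming (+_ to ι)
open import Data.List using (List; []; _∷_; _++_; map; replicate; foldr)
open import Data.List.Properties using (foldr-fusion)
open import Data.Product using (_×_; _,_; proj₁; proj₂; ∃)
open import Data.Sum using (_⊎_; inj₁; inj₂)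
open import Data.List.Relation.Unary.All using (All; []; _∷_)
import Data.List.Relation.Unary.All as All
import Data.List.Relation.Unary.All.Properties as All
open import Data.List.Relation.Unary.Any using (Any; here; there)
import Data.List.Relation.Unary.Any as Any
import Data.List.Relation.Unary.Any.Properties as Any
open import Data.Nat.Solver using (module +-*-Solver)
open +-*-Solver using (solve; _:+_; _:*_; _:=_; con)

_⊕ⁿ_ : List ℕ → List ℕ → List ℕ
[]      ⊕ⁿ q       = q
(a ∷ p) ⊕ⁿ []      = a ∷ p
(a ∷ p) ⊕ⁿ (b ∷ q) = (a + b) ∷ (p ⊕ⁿ q)

shiftⁿ : ℕ → List ℕ → List ℕ
shiftⁿ r p = replicate r 0 ++ p

_⊔ᵐ_ : Maybe ℕ → Maybe ℕ → Maybe ℕ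
nothing ⊔ᵐ y        = y
just a  ⊔ᵐ nothing  = just a
just a  ⊔ᵐ (just b) = just (a ⊔ b)

⊔ᵐ-identityʳ : ∀ x → x ⊔ᵐ nothing ≡ x
⊔ᵐ-identityʳ nothing  = refl
⊔ᵐ-identityʳ (just _) = refl

degStep : ℕ → Maybe ℕ → Maybe ℕ
degStep a       (just d) = just (suc d)
degStep zero    nothing  = nothing
degStep (suc _) nothing  = just 0

degⁿ : List ℕ → Maybe ℕ
degⁿ []      = nothing
degⁿ (a ∷ p) = degStep a (degⁿ p)

-- Adding natural numbers can create no zero from nonzero summands, so
-- degStep commutes with maxima.
degStep-⊔ᵐ : ∀ a b x y → degStep (a + b) (x ⊔ᵐ y) ≡ degStep a x ⊔ᵐ degStep b y
degStep-⊔ᵐ a       b       (just _) (just _) = refl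
degStep-⊔ᵐ a       zero    (just _) nothing  = refl
degStep-⊔ᵐ a       (suc _) (just _) nothing  = refl
degStep-⊔ᵐ zero    b       nothing  (just _) = refl
degStep-⊔ᵐ (suc _) b       nothing  (just _) = refl
degStep-⊔ᵐ zero    zero    nothing  nothing  = refl
degStep-⊔ᵐ zero    (suc _) nothing  nothing  = refl
degStep-⊔ᵐ (suc _) zero    nothing  nothing  = refl
degStep-⊔ᵐ (suc _) (suc _) nothing  nothing  = refl

degⁿ-⊕ⁿ : ∀ p q → degⁿ (p ⊕ⁿ q) ≡ degⁿ p ⊔ᵐ degⁿ q
degⁿ-⊕ⁿ []      q       = refl
degⁿ-⊕ⁿ (a ∷ p) []      = sym (⊔ᵐ-identityʳ _)
degⁿ-⊕ⁿ (a ∷ p) (b ∷ q) rewrite degⁿ-⊕ⁿ p q = degStep-⊔ᵐ a b (degⁿ p) (degⁿ q)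

degⁿ-shiftⁿ : ∀ r p {d} → degⁿ p ≡ just d → degⁿ (shiftⁿ r p) ≡ just (r + d)
degⁿ-shiftⁿ zero    p eq = eq
degⁿ-shiftⁿ (suc r) p eq rewrite degⁿ-shiftⁿ r p eq = refl

embed : List ℕ → Poly
embed = map ι

embed-⊕ⁿ : ∀ p q → embed (p ⊕ⁿ q) ≡ embed p ⊕ embed q
embed-⊕ⁿ []      q       = refl
embed-⊕ⁿ (a ∷ p) []      = refl
embed-⊕ⁿ (a ∷ p) (b ∷ q) = cong (ι (a + b) ∷_) (embed-⊕ⁿ p q)

embed-shiftⁿ : ∀ r p → embed (shiftⁿ r p) ≡ shift r (embed p)
embed-shiftⁿ zero    p = refl
embed-shiftⁿ (suc r) p = cong (ι 0 ∷_) (embed-shiftⁿ r p)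

deg-embed : ∀ p → deg (embed p) ≡ degⁿ p
deg-embed []      = refl
deg-embed (a ∷ p) rewrite deg-embed p with degⁿ p
... | just _  = refl
deg-embed (zero  ∷ p) | nothing = refl
deg-embed (suc _ ∷ p) | nothing = refl

mutual
  Qfⁿ : ℕ → Tree → List ℕ
  Qfⁿ _       (node []) = 1 ∷ []
  Qfⁿ zero    t         = 1 ∷ []
  Qfⁿ (suc n) t         = foldr (pluckTerm n) [] (plucks t)

  pluckTerm : ℕ → ℕ × Tree → List ℕ → List ℕ
  pluckTerm n (r , t) acc = shiftⁿ r (Qfⁿ n t) ⊕ⁿ acc

Qf≡embed : ∀ n t → Qf n t ≡ embed (Qfⁿ n t)
Qf≡embed n       (node [])       = refl
Qf≡embed zero    (node (_ ∷ _)) = refl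
Qf≡embed (suc n) (node (c ∷ cs)) =
  sym (foldr-fusion embed [] embed-term (plucks (node (c ∷ cs))))
  where
  open ≡-Reasoning
  embed-term : ∀ p acc →
    embed (pluckTerm n p acc) ≡ shift (proj₁ p) (Qf n (proj₂ p)) ⊕ embed acc
  embed-term (r , t) acc = begin
    embed (shiftⁿ r (Qfⁿ n t) ⊕ⁿ acc)          ≡⟨ embed-⊕ⁿ (shiftⁿ r (Qfⁿ n t)) acc ⟩
    embed (shiftⁿ r (Qfⁿ n t)) ⊕ embed acc     ≡⟨ cong (_⊕ embed acc) (embed-shiftⁿ r (Qfⁿ n t)) ⟩
    shift r (embed (Qfⁿ n t)) ⊕ embed acc      ≡⟨ cong (λ p → shift r p ⊕ embed acc) (sym (Qf≡embed n t)) ⟩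
    shift r (Qf n t) ⊕ embed acc               ∎

maximum : List ℕ → Maybe ℕ
maximum []       = nothing
maximum (x ∷ xs) = just x ⊔ᵐ maximum xs

maximum-≤ : ∀ {V} xs → All (_≤ V) xs →
  maximum xs ≡ nothing ⊎ ∃ λ W → maximum xs ≡ just W × W ≤ V
maximum-≤ []       []         = inj₁ refl
maximum-≤ (x ∷ xs) (x≤ ∷ xs≤) with maximum-≤ xs xs≤
... | inj₁ eq             rewrite eq = inj₂ (x , refl , x≤)
... | inj₂ (W , eq , W≤V) rewrite eq = inj₂ (x ⊔ W , refl , ⊔-lub x≤ W≤V)

maximum-attained : ∀ {V} xs → All (_≤ V) xs → Any (_≡ V) xs → maximum xs ≡ just V
maximum-attained (x ∷ xs) (x≤ ∷ xs≤) (here refl) with maximum-≤ xs xs≤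
... | inj₁ eq             rewrite eq = refl
... | inj₂ (W , eq , W≤V) rewrite eq = cong just (m≥n⇒m⊔n≡m W≤V)
maximum-attained (x ∷ xs) (x≤ ∷ xs≤) (there any) rewrite maximum-attained xs xs≤ any =
  cong just (m≤n⇒m⊔n≡n x≤)

Φ : List Tree → ℕ
Φ cs = vertexSum (node cs)

E : List Tree → ℕ
E = forestEdges

sum-branchSizes : ∀ cs → foldr _+_ 0 (branchSizes cs) ≡ E cs
sum-branchSizes []       = refl
sum-branchSizes (c ∷ cs) = cong (suc (edges c) +_) (sum-branchSizes cs)

-- Adding a branch c to the left of cs: the pairs it forms with the other
-- branches contribute (1 + |E(c)|) · E cs, its own vertices vertexSum c.
Φ-cons : ∀ c cs → Φ (c ∷ cs) ≡ suc (edges c) * E cs + vertexSum c + Φ cs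
Φ-cons c cs rewrite sum-branchSizes cs =
  solve 4 (λ A P B F → (A :+ P) :+ (B :+ F) := A :+ B :+ (P :+ F)) refl
    (suc (edges c) * E cs) (pairSum (branchSizes cs)) (vertexSum c) (forestVertexSum cs)

-- A leftmost edge ending in a leaf: its pairs with the others give E cs.
Φ-leaf : ∀ cs → E cs + Φ cs ≡ Φ (node [] ∷ cs)
Φ-leaf cs rewrite Φ-cons (node []) cs =
  solve 2 (λ X F → X :+ F := (con 1 :+ con 0) :* X :+ con 0 :+ F) refl (E cs) (Φ cs)

Φ-branch : ∀ ds cs → Φ (node ds ∷ cs) ≡ Φ ds + (suc (E ds) * E cs + Φ cs)
Φ-branch ds cs rewrite Φ-cons (node ds) cs =
  solve 4 (λ A X B F → A :+ B :+ F := B :+ (A :+ F)) refl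
    (suc (E ds) * E cs) (E cs) (Φ ds) (Φ cs)

-- Plucking inside the leftmost branch node ds (leaving ds' with one edge
-- less): the edges right of the branch add E cs to r, and the rest of Φ
-- is unchanged.
Φ-pluck-branch : ∀ r ds' ds cs → suc (E ds') ≡ E ds →
  r + E cs + Φ (node ds' ∷ cs) ≡ (r + Φ ds') + (suc (E ds) * E cs + Φ cs)
Φ-pluck-branch r ds' ds cs e rewrite sym e | Φ-cons (node ds') cs =
  solve 5 (λ r X a B F → r :+ X :+ ((con 1 :+ a) :* X :+ B :+ F)
                       := (r :+ B) :+ ((con 2 :+ a) :* X :+ F))
    refl r (E cs) (E ds') (Φ ds') (Φ cs)

WellPlucked : List Tree → ℕ × List Tree → Set
WellPlucked cs (r , cs') = suc (E cs') ≡ E cs × r + Φ cs' ≤ Φ cs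

Tight : List Tree → ℕ × List Tree → Set
Tight cs (r , cs') = r + Φ cs' ≡ Φ cs

lift-leftmost : ∀ ds cs {p} → WellPlucked ds p →
  WellPlucked (node ds ∷ cs) (proj₁ p + E cs , node (proj₂ p) ∷ cs)
lift-leftmost ds cs {r , ds'} (e , le) = cong (λ x → suc x + E cs) e , (begin
  r + E cs + Φ (node ds' ∷ cs)           ≡⟨ Φ-pluck-branch r ds' ds cs e ⟩
  (r + Φ ds') + (suc (E ds) * E cs + Φ cs) ≤⟨ +-monoˡ-≤ _ le ⟩
  Φ ds + (suc (E ds) * E cs + Φ cs)      ≡⟨ sym (Φ-branch ds cs) ⟩
  Φ (node ds ∷ cs)                       ∎)
  where open ≤-Reasoning

lift-leftmost-tight : ∀ ds cs {p} → WellPlucked ds p → Tight ds p →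
  Tight (node ds ∷ cs) (proj₁ p + E cs , node (proj₂ p) ∷ cs)
lift-leftmost-tight ds cs {r , ds'} (e , _) t = begin
  r + E cs + Φ (node ds' ∷ cs)             ≡⟨ Φ-pluck-branch r ds' ds cs e ⟩
  (r + Φ ds') + (suc (E ds) * E cs + Φ cs) ≡⟨ cong (_+ (suc (E ds) * E cs + Φ cs)) t ⟩
  Φ ds + (suc (E ds) * E cs + Φ cs)        ≡⟨ sym (Φ-branch ds cs) ⟩
  Φ (node ds ∷ cs)                         ∎
  where open ≡-Reasoning

-- Lifting a plucking of cs past a new leftmost branch c: r is unchanged,
-- while the pairs formed with c lose c's share of the removed edge.
lift-right : ∀ c cs {p} → WellPlucked cs p →
  WellPlucked (c ∷ cs) (proj₁ p , c ∷ proj₂ p)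
lift-right c cs {r , cs'} (e , le) =
  trans (sym (+-suc (suc (edges c)) (E cs'))) (cong (suc (edges c) +_) e) , (begin
    r + Φ (c ∷ cs')                      ≡⟨ cong (r +_) (Φ-cons c cs') ⟩
    r + (A * E cs' + vertexSum c + Φ cs') ≡⟨ reorder r (A * E cs') (vertexSum c) (Φ cs') ⟩
    A * E cs' + vertexSum c + (r + Φ cs') ≤⟨ +-mono-≤ (+-monoˡ-≤ (vertexSum c) (*-monoʳ-≤ A E-cs'≤E-cs)) le ⟩
    A * E cs + vertexSum c + Φ cs         ≡⟨ sym (Φ-cons c cs) ⟩
    Φ (c ∷ cs)                            ∎)
  where
  open ≤-Reasoning
  A = suc (edges c)
  E-cs'≤E-cs : E cs' ≤ E cs
  E-cs'≤E-cs = ≤-trans (n≤1+n _) (≤-reflexive e)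
  reorder : ∀ r x b f → r + (x + b + f) ≡ x + b + (r + f)
  reorder = solve 4 (λ r x b f → r :+ (x :+ b :+ f) := x :+ b :+ (r :+ f)) refl

allWellPlucked : ∀ cs → All (WellPlucked cs) (pluckF cs)
allWellPlucked [] = []
allWellPlucked (node [] ∷ cs) =
  (refl , ≤-reflexive (Φ-leaf cs))
  ∷ All.map⁺ (All.map (λ {p} → lift-right (node []) cs {p}) (allWellPlucked cs))
allWellPlucked (node ds@(_ ∷ _) ∷ cs) = All.++⁺
  (All.map⁺ (All.map (λ {p} → lift-leftmost ds cs {p}) (allWellPlucked ds)))
  (All.map⁺ (All.map (λ {p} → lift-right (node ds) cs {p}) (allWellPlucked cs)))

leftmostTight : ∀ c cs → Any (λ p → WellPlucked (c ∷ cs) p × Tight (c ∷ cs) p) (pluckF (c ∷ cs))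
leftmostTight (node [])       cs = here ((refl , ≤-reflexive (Φ-leaf cs)) , Φ-leaf cs)
leftmostTight (node (d ∷ ds)) cs =
  Any.++⁺ˡ (Any.map⁺ (Any.map (λ {p} (wp , t) →
    lift-leftmost (d ∷ ds) cs {p} wp , lift-leftmost-tight (d ∷ ds) cs {p} wp t)
    (leftmostTight d ds)))

-- r(T,v) + deg Q(T - v): the degree of the summand of leaf v.
summandDegree : ℕ × Tree → ℕ
summandDegree (r , t) = r + vertexSum t

degⁿ-pluckSum : ∀ n ps → All (λ p → degⁿ (Qfⁿ n (proj₂ p)) ≡ just (vertexSum (proj₂ p))) ps →
  degⁿ (foldr (pluckTerm n) [] ps) ≡ maximum (map summandDegree ps)
degⁿ-pluckSum n []            []         = refl
degⁿ-pluckSum n ((r , t) ∷ ps) (ih ∷ ihs)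
  rewrite degⁿ-⊕ⁿ (shiftⁿ r (Qfⁿ n t)) (foldr (pluckTerm n) [] ps)
        | degⁿ-shiftⁿ r (Qfⁿ n t) ih
        | degⁿ-pluckSum n ps ihs = refl

degⁿ-Qfⁿ : ∀ n t → edges t ≡ n → degⁿ (Qfⁿ n t) ≡ just (vertexSum t)
degⁿ-Qfⁿ n       (node [])       _     = refl
degⁿ-Qfⁿ (suc n) (node (c ∷ cs)) edges≡ =
  trans (degⁿ-pluckSum n ps inductionHyp) (maximum-attained (map summandDegree ps) bounded attained)
  where
  ps = plucks (node (c ∷ cs))
  inductionHyp : All (λ p → degⁿ (Qfⁿ n (proj₂ p)) ≡ just (vertexSum (proj₂ p))) ps
  inductionHyp = All.map⁺ (All.map (λ {p} wp →
    degⁿ-Qfⁿ n (node (proj₂ p)) (suc-injective (trans (proj₁ wp) edges≡)))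
    (allWellPlucked (c ∷ cs)))
  bounded : All (_≤ vertexSum (node (c ∷ cs))) (map summandDegree ps)
  bounded = All.map⁺ (All.map⁺ (All.map proj₂ (allWellPlucked (c ∷ cs))))
  attained : Any (_≡ vertexSum (node (c ∷ cs))) (map summandDegree ps)
  attained = Any.map⁺ (Any.map⁺ (Any.map proj₂ (leftmostTight c cs)))

corollary2p4 : (T : Tree) → deg (Q T) ≡ just (vertexSum T)
corollary2p4 T = begin
  deg (Qf (edges T) T)            ≡⟨ cong deg (Qf≡embed (edges T) T) ⟩
  deg (embed (Qfⁿ (edges T) T))   ≡⟨ deg-embed (Qfⁿ (edges T) T) ⟩
  degⁿ (Qfⁿ (edges T) T)          ≡⟨ degⁿ-Qfⁿ (edges T) T refl ⟩
  just (vertexSum T)              ∎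
  where open ≡-Reasoning
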